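{- For every $m\ge1$, $\mathbb{H}^0(K_m)\cong\mathbb{F}_{(1)}$, generated by the sum of the (single-vertex) black subgraphs of the $m$ colourings with exactly one black vertex.
   Context: $\mathbb{F}$ is the field with two elements and $K_m$ is the complete graph on $m$ vertices. For a simple graph $G$ with vertices $v_1,\dots,v_m$ and a colouring $\varepsilon\in\mathbb{Z}_2^m$ ($v_i$ black iff $\varepsilon(i)=1$; $|\varepsilon|$ the number of black vertices), $Bl(G,\varepsilon)$ is the subgraph induced on the black vertices, and $\pi_0$ denotes its set of connected components. Let $\mathcal{C}^j(G)=\bigoplus_{|\varepsilon|=j}\mathbb{F}\langle\pi_0(Bl(G,\varepsilon))\rangle$ for $j=0,\dots,m$ (so $\mathcal{C}^0(G)=0$), with differential $\mathcal{C}^j\to\mathcal{C}^{j+1}$ the sum, over all pairs $\varepsilon,\varepsilon'$ with $|\varepsilon|=j$ differing in exactly one entry (where $\varepsilon'$ has one more black vertex), of the linear maps induced on components by the inclusion $Bl(G,\varepsilon)\subset Bl(G,\varepsilon')$. $\mathbb{H}^0(G)$ is the homology of this complex (equivalently, the \"uberhomology of $G$ in bidegree (dimension, weight) $=(0,0)$); $\mathbb{F}_{(1)}$ denotes a copy of $\mathbb{F}$ in homological degree $j=1$. -}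

module Defs where

open import Data.Nat using (ℕ; zero; suc)
open import Data.Bool using (Bool; true; false; _∧_; _∨_; _xor_; not; if_then_else_)
import Data.Bool as B
open import Data.Fin using (Fin; zero; suc)
import Data.Fin as F
open import Data.Fin.Subset using (Subset; _∈_; ⁅_⁆; ∣_∣)
open import Data.Vec using (Vec; []; _∷_; lookup; _[_]≔_)
open import Data.Vec.Properties using (≡-dec)
open import Data.List using (List; []; _∷_; map; foldr; _++_)
open import Data.List as L using ()
import Data.Bool.ListAction as BL
open import Data.Product using (Σ; _×_; _,_)
open import Relation.Binary.PropositionalEquality using (_≡_; refl)
open import Relation.Nullary.Decidable using (⌊_⌋)
open import Function.Bundles using (_⇔_)

record SimpleGraph (m : ℕ) : Set where
  field
    adj   : Fin m → Fin m → Bool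
    adj-sym : ∀ u v → adj u v ≡ adj v u
    adj-irrefl : ∀ v → adj v v ≡ false
open SimpleGraph public

K : (m : ℕ) → SimpleGraph m
K m = record
  { adj = λ u v → not ⌊ u F.≟ v ⌋
  ; adj-sym = λ u v → symK u v
  ; adj-irrefl = irK
  }
  where
  open import Relation.Nullary using (yes; no)
  open import Relation.Binary.PropositionalEquality using (sym)
  symK : ∀ (u v : Fin m) → not ⌊ u F.≟ v ⌋ ≡ not ⌊ v F.≟ u ⌋
  symK u v with u F.≟ v | v F.≟ u
  ... | yes _ | yes _ = refl
  ... | no _ | no _ = refl
  ... | yes p | no q with q (sym p)
  ... | ()
  symK u v | no q | yes p with q (sym p)
  ... | ()
  irK : ∀ (v : Fin m) → not ⌊ v F.≟ v ⌋ ≡ false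
  irK v with v F.≟ v
  ... | yes _ = refl
  ... | no q with q refl
  ... | ()

-- A colouring ε ∈ Z_2^m is a subset of the vertices (the black ones).
Colouring : ℕ → Set
Colouring = Subset

data BlPath {m : ℕ} (G : SimpleGraph m) (ε : Colouring m) : Fin m → Fin m → Set where
  here : ∀ {v} → v ∈ ε → BlPath G ε v v
  step : ∀ {u v w} → u ∈ ε → adj G u v ≡ true → BlPath G ε v w → BlPath G ε u w

IsComponent : ∀ {m} → SimpleGraph m → Colouring m → Subset m → Set
IsComponent {m} G ε S =
  Σ (Fin m) λ v → (v ∈ ε) × (∀ w → (w ∈ S) ⇔ BlPath G ε v w)

-- Chains over F = Z/2: a chain assigns to each pair (ε, S) a coefficient in F;
-- the basis element (ε,S) is meaningful when S ∈ π₀(Bl(G,ε)).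
Chain : ℕ → Set
Chain m = Colouring m → Subset m → Bool

InC : ∀ {m} → SimpleGraph m → ℕ → Chain m → Set
InC G j c = ∀ ε S → c ε S ≡ true → (∣ ε ∣ ≡ j) × IsComponent G ε S

_≈[_,_]_ : ∀ {m} → Chain m → SimpleGraph m → ℕ → Chain m → Set
c ≈[ G , j ] c' = ∀ ε S → ∣ ε ∣ ≡ j → IsComponent G ε S → c ε S ≡ c' ε S

zeroC : ∀ {m} → Chain m
zeroC _ _ = false

_+C_ : ∀ {m} → Chain m → Chain m → Chain m
(c +C c') ε S = c ε S xor c' ε S

⊕ : List Bool → Bool
⊕ = foldr _xor_ false

allFin : ∀ m → List (Fin m)
allFin m = L.allFin m

allSubsets : ∀ m → List (Subset m)
allSubsets zero = [] ∷ []
allSubsets (suc m) = map (true ∷_) (allSubsets m) ++ map (false ∷_) (allSubsets m)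

_⊆ᵇ_ : ∀ {m} → Subset m → Subset m → Bool
S ⊆ᵇ S' = BL.all (λ i → not (lookup S i) ∨ lookup S' i) (allFin _)

-- For a component S' of Bl(G,ε') its coefficient
-- is the sum, over black vertices i of ε' (ε = ε' with i made white) and over
-- components S of Bl(G,ε) with S ⊆ S' (i.e. the inclusion maps S to S'), of c(ε,S).
-- (Applied to c ∈ C^j, only components S of Bl(G,ε) contribute.)
d : ∀ {m} → SimpleGraph m → Chain m → Chain m
d {m} G c ε' S' =
  ⊕ (map (λ i → if lookup ε' i
                  then ⊕ (map (λ S → c (ε' [ i ]≔ false) S ∧ (S ⊆ᵇ S')) (allSubsets m))
                  else false)
         (allFin m))

IsCycle : ∀ {m} → SimpleGraph m → ℕ → Chain m → Set
IsCycle G j c = InC G j c × (d G c ≈[ G , suc j ] zeroC)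

-- Boundaries in C^j (image of C^{j-1} → C^j; C^{-1} = 0).
IsBoundary : ∀ {m} → SimpleGraph m → ℕ → Chain m → Set
IsBoundary G zero c = c ≈[ G , zero ] zeroC
IsBoundary {m} G (suc k) c = Σ (Chain m) λ b → InC G k b × (d G b ≈[ G , suc k ] c)

singletonSum : ∀ m → Chain m
singletonSum m ε S =
  BL.any (λ i → ⌊ ≡-dec B._≟_ ε ⁅ i ⁆ ⌋ ∧ ⌊ ≡-dec B._≟_ S ⁅ i ⁆ ⌋) (allFin m)

-- In K_m every nonempty black subgraph is connected, so π₀(Bl(K_m, ε)) = {ε} for ε ≠ ∅ and the
-- complex is the cochain complex of the Boolean cube, f ↦ ∂f with (∂f)(ε) = Σ_{i∈ε} f(ε ∖ i),
-- except that the empty colouring is missing in degree 0.  The full cube complex is contractible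
-- through the cone on the vertex 0, (cone f)(σ) = f(σ ∪ {0}) for 0 ∉ σ, since ∂ ∘ cone + cone ∘ ∂ = id.
-- So every j-cycle c is the coboundary of its cone, a (j−1)-chain.  For j ≥ 2 this is a chain of
-- the complex; for j = 1 it is the constant c({0}) on ∅, whose coboundary is c({0}) times the sum
-- of the singletons.
module Submission where

open import Defs
open import Data.Nat using (ℕ; _≤_)
open import Data.Sum using (_⊎_)
open import Data.Product using (_×_)
open import Relation.Binary.PropositionalEquality using (_≢_)
open import Relation.Nullary using (¬_)

open import Data.Nat using (zero; suc; _≡ᵇ_)
open import Data.Nat.Properties using (suc-injective; ≡ᵇ⇒≡; ≡⇒≡ᵇ)
open import Data.Bool using (Bool; true; false; _∧_; _∨_; _xor_; not; if_then_else_)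
import Data.Bool as B
open import Data.Bool.Properties
  using (xor-same; xor-comm; xor-assoc; xor-identityʳ; ∧-identityʳ; ∧-conicalˡ; ∧-conicalʳ;
         ∨-inverseˡ; T-≡; T-∧; ⇔→≡)
open import Data.Fin as F using (Fin; zero; suc)
open import Data.Fin.Subset using (Subset; _∈_; ⁅_⁆; ∣_∣; ⊥; Nonempty)
open import Data.Fin.Subset.Properties using (x∈⁅x⁆; ∣⁅x⁆∣≡1; ⊆-antisym; Empty-unique)
open import Data.Vec using (_∷_; []; lookup; _[_]≔_; here; there)
open import Data.Vec.Properties using (≡-dec; ∷-injective)
open import Data.List using ([]; _∷_; map; _++_; tabulate)
import Data.List.Properties as List
open import Data.List.Relation.Unary.All using (universal)
open import Data.List.Relation.Unary.All.Properties using (all⁻)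
open import Data.List.Relation.Unary.Any using (satisfied)
open import Data.List.Relation.Unary.Any.Properties using (any⁺; any⁻)
open import Data.List.Membership.Propositional using (lose)
open import Data.List.Membership.Propositional.Properties using (∈-allFin)
open import Data.Product using (Σ; _,_; proj₁; proj₂)
open import Data.Sum using (inj₁; inj₂)
open import Relation.Binary.Definitions using (DecidableEquality)
open import Relation.Binary.PropositionalEquality using (_≡_; refl; sym; trans; cong; cong₂; module ≡-Reasoning)
open import Relation.Nullary using (Dec; yes; no; contradiction)
open import Relation.Nullary.Decidable using (⌊_⌋; toWitness; fromWitness)
open import Function using (_∘_; id)
open import Function.Bundles using (mk⇔; Equivalence)

open ≡-Reasoning

⌊⌋≡true⇒ : ∀ {A : Set} (a? : Dec A) → ⌊ a? ⌋ ≡ true → A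
⌊⌋≡true⇒ (yes a) _ = a
⌊⌋≡true⇒ (no _) ()

⌊⌋-true : ∀ {A : Set} (a? : Dec A) → A → ⌊ a? ⌋ ≡ true
⌊⌋-true (yes _) _ = refl
⌊⌋-true (no ¬a) a = contradiction a ¬a

⌊⌋-false : ∀ {A : Set} (a? : Dec A) → ¬ A → ⌊ a? ⌋ ≡ false
⌊⌋-false (yes a) ¬a = contradiction a ¬a
⌊⌋-false (no _) _ = refl

_≟ˢ_ : ∀ {n} → DecidableEquality (Subset n)
_≟ˢ_ = ≡-dec B._≟_

∈⇒∣p∣≢0 : ∀ {n} {x : Fin n} {p : Subset n} → x ∈ p → ∣ p ∣ ≢ 0
∈⇒∣p∣≢0 {p = true ∷ _} here ()
∈⇒∣p∣≢0 {p = true ∷ _} (there _) ()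
∈⇒∣p∣≢0 {p = false ∷ _} (there x∈p) = ∈⇒∣p∣≢0 x∈p

∣p∣≡suc⇒Nonempty : ∀ {n k} (p : Subset n) → ∣ p ∣ ≡ suc k → Nonempty p
∣p∣≡suc⇒Nonempty (true ∷ _) _ = zero , here
∣p∣≡suc⇒Nonempty (false ∷ p) ∣p∣≡1+k with ∣p∣≡suc⇒Nonempty p ∣p∣≡1+k
... | x , x∈p = suc x , there x∈p

∣p∣≡1⇒p≡⁅x⁆ : ∀ {n} (p : Subset n) → ∣ p ∣ ≡ 1 → Σ (Fin n) λ x → p ≡ ⁅ x ⁆
∣p∣≡1⇒p≡⁅x⁆ (true ∷ p) ∣p∣≡1 =
  zero , cong (true ∷_) (Empty-unique λ (x , x∈p) → ∈⇒∣p∣≢0 x∈p (suc-injective ∣p∣≡1))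
∣p∣≡1⇒p≡⁅x⁆ (false ∷ p) ∣p∣≡1 with ∣p∣≡1⇒p≡⁅x⁆ p ∣p∣≡1
... | x , refl = suc x , refl

lookup-[]≔false-⊆ : ∀ {n} (ε : Subset n) i k → not (lookup (ε [ i ]≔ false) k) ∨ lookup ε k ≡ true
lookup-[]≔false-⊆ (_ ∷ _) zero zero = refl
lookup-[]≔false-⊆ (_ ∷ ε) zero (suc k) = ∨-inverseˡ (lookup ε k)
lookup-[]≔false-⊆ (x ∷ _) (suc i) zero = ∨-inverseˡ x
lookup-[]≔false-⊆ (_ ∷ ε) (suc i) (suc k) = lookup-[]≔false-⊆ ε i k

[]≔false-⊆ᵇ : ∀ {n} (ε : Subset n) i → ((ε [ i ]≔ false) ⊆ᵇ ε) ≡ true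
[]≔false-⊆ᵇ ε i = Equivalence.to T-≡
  (all⁻ _ (universal (λ k → Equivalence.from T-≡ (lookup-[]≔false-⊆ ε i k)) (allFin _)))

-- Black subgraphs of the complete graph

BlPath-end : ∀ {m} {G : SimpleGraph m} {ε v w} → BlPath G ε v w → w ∈ ε
BlPath-end (here w∈ε) = w∈ε
BlPath-end (step _ _ path) = BlPath-end path

BlPath-K : ∀ {m} {ε : Subset m} {v w} → v ∈ ε → w ∈ ε → BlPath (K m) ε v w
BlPath-K {v = v} {w} v∈ε w∈ε with v F.≟ w
... | yes refl = here v∈ε
... | no v≢w = step v∈ε (cong not (⌊⌋-false (v F.≟ w) v≢w)) (here w∈ε)

isComponent-K : ∀ {m} {ε : Subset m} {v} → v ∈ ε → IsComponent (K m) ε ε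
isComponent-K {v = v} v∈ε = v , v∈ε , λ w → mk⇔ (BlPath-K v∈ε) BlPath-end

isComponent-K⇒≡ : ∀ {m} {ε S : Subset m} → IsComponent (K m) ε S → S ≡ ε
isComponent-K⇒≡ (v , v∈ε , S≡π) = ⊆-antisym
  (λ {w} w∈S → BlPath-end (Equivalence.to (S≡π w) w∈S))
  (λ {w} w∈ε → Equivalence.from (S≡π w) (BlPath-K v∈ε w∈ε))

⊕-map-false : ∀ {A : Set} (g : A → Bool) xs → (∀ x → g x ≡ false) → ⊕ (map g xs) ≡ false
⊕-map-false g [] _ = refl
⊕-map-false g (x ∷ xs) g≡false rewrite g≡false x = ⊕-map-false g xs g≡false

⊕-++ : ∀ xs ys → ⊕ (xs ++ ys) ≡ ⊕ xs xor ⊕ ys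
⊕-++ [] ys = refl
⊕-++ (x ∷ xs) ys = trans (cong (x xor_) (⊕-++ xs ys)) (sym (xor-assoc x (⊕ xs) (⊕ ys)))

⊕-allSubsets-suc : ∀ {m} (g : Subset (suc m) → Bool) →
  ⊕ (map g (allSubsets (suc m))) ≡
  ⊕ (map (g ∘ (true ∷_)) (allSubsets m)) xor ⊕ (map (g ∘ (false ∷_)) (allSubsets m))
⊕-allSubsets-suc {m} g = begin
  ⊕ (map g (map (true ∷_) A ++ map (false ∷_) A))
    ≡⟨ cong ⊕ (List.map-++ g (map (true ∷_) A) (map (false ∷_) A)) ⟩
  ⊕ (map g (map (true ∷_) A) ++ map g (map (false ∷_) A))
    ≡⟨ ⊕-++ (map g (map (true ∷_) A)) (map g (map (false ∷_) A)) ⟩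
  ⊕ (map g (map (true ∷_) A)) xor ⊕ (map g (map (false ∷_) A))
    ≡⟨ sym (cong₂ _xor_ (cong ⊕ (List.map-∘ A)) (cong ⊕ (List.map-∘ A))) ⟩
  ⊕ (map (g ∘ (true ∷_)) A) xor ⊕ (map (g ∘ (false ∷_)) A) ∎
  where A = allSubsets m

SupportedAt : ∀ {m} → (Subset m → Bool) → Subset m → Set
SupportedAt g T = ∀ S → g S ≡ true → S ≡ T

SupportedAt-tail : ∀ {m} {g : Subset (suc m) → Bool} {x T} y →
  SupportedAt g (x ∷ T) → SupportedAt (g ∘ (y ∷_)) T
SupportedAt-tail _ supp S gS = proj₂ (∷-injective (supp _ gS))

SupportedAt-head : ∀ {m} {g : Subset (suc m) → Bool} {x T} y →
  SupportedAt g (x ∷ T) → y ≢ x → ∀ S → g (y ∷ S) ≡ false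
SupportedAt-head {g = g} y supp y≢x S with g (y ∷ S) in gS
... | false = refl
... | true = contradiction (proj₁ (∷-injective (supp _ gS))) y≢x

⊕-allSubsets-SupportedAt : ∀ {m} (g : Subset m → Bool) T →
  SupportedAt g T → ⊕ (map g (allSubsets m)) ≡ g T
⊕-allSubsets-SupportedAt {zero} g [] _ = xor-identityʳ (g [])
⊕-allSubsets-SupportedAt {suc m} g (true ∷ T) supp = begin
  ⊕ (map g (allSubsets (suc m)))                                          ≡⟨ ⊕-allSubsets-suc g ⟩
  ⊕ (map (g ∘ (true ∷_)) A) xor ⊕ (map (g ∘ (false ∷_)) A)
    ≡⟨ cong₂ _xor_ (⊕-allSubsets-SupportedAt _ T (SupportedAt-tail true supp))
                   (⊕-map-false _ A (SupportedAt-head false supp λ ())) ⟩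
  g (true ∷ T) xor false                                                  ≡⟨ xor-identityʳ _ ⟩
  g (true ∷ T) ∎
  where A = allSubsets m
⊕-allSubsets-SupportedAt {suc m} g (false ∷ T) supp = begin
  ⊕ (map g (allSubsets (suc m)))                                          ≡⟨ ⊕-allSubsets-suc g ⟩
  ⊕ (map (g ∘ (true ∷_)) A) xor ⊕ (map (g ∘ (false ∷_)) A)
    ≡⟨ cong₂ _xor_ (⊕-map-false _ A (SupportedAt-head true supp λ ()))
                   (⊕-allSubsets-SupportedAt _ T (SupportedAt-tail false supp)) ⟩
  g (false ∷ T) ∎
  where A = allSubsets m

-- The cochain complex of the Boolean cube

∂ : ∀ {n} → (Subset n → Bool) → Subset n → Bool
∂ f ε = ⊕ (tabulate λ i → if lookup ε i then f (ε [ i ]≔ false) else false)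

∂-cong : ∀ {n} {f g : Subset n → Bool} → (∀ σ → f σ ≡ g σ) → ∀ ε → ∂ f ε ≡ ∂ g ε
∂-cong f≗g [] = refl
∂-cong f≗g (x ∷ σ) =
  cong₂ _xor_ (cong (if x then_else false) (f≗g (false ∷ σ))) (∂-cong (f≗g ∘ (x ∷_)) σ)

∂-false : ∀ {n} (ε : Subset n) → ∂ (λ _ → false) ε ≡ false
∂-false [] = refl
∂-false (true ∷ σ) = ∂-false σ
∂-false (false ∷ σ) = ∂-false σ

∂-⊥ : ∀ {n} (g : Subset n → Bool) → ∂ g ⊥ ≡ false
∂-⊥ {zero} g = refl
∂-⊥ {suc n} g = ∂-⊥ (g ∘ (false ∷_))

∂-⁅⁆ : ∀ {n} (g : Subset n → Bool) i → ∂ g ⁅ i ⁆ ≡ g ⊥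
∂-⁅⁆ g zero = trans (cong (g ⊥ xor_) (∂-⊥ (g ∘ (true ∷_)))) (xor-identityʳ (g ⊥))
∂-⁅⁆ g (suc i) = ∂-⁅⁆ (g ∘ (false ∷_)) i

cone : ∀ {n} → (Subset (suc n) → Bool) → Subset (suc n) → Bool
cone f (true ∷ σ) = false
cone f (false ∷ σ) = f (true ∷ σ)

∂-cone : ∀ {n} (f : Subset (suc n) → Bool) τ → ∂ (cone f) τ xor cone (∂ f) τ ≡ f τ
∂-cone f (true ∷ σ) = begin
  (f (true ∷ σ) xor ∂ (λ _ → false) σ) xor false   ≡⟨ xor-identityʳ _ ⟩
  f (true ∷ σ) xor ∂ (λ _ → false) σ               ≡⟨ cong (f (true ∷ σ) xor_) (∂-false σ) ⟩
  f (true ∷ σ) xor false                           ≡⟨ xor-identityʳ _ ⟩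
  f (true ∷ σ) ∎
∂-cone f (false ∷ σ) = begin
  a xor (f (false ∷ σ) xor a)   ≡⟨ cong (a xor_) (xor-comm (f (false ∷ σ)) a) ⟩
  a xor (a xor f (false ∷ σ))   ≡⟨ sym (xor-assoc a a _) ⟩
  (a xor a) xor f (false ∷ σ)   ≡⟨ cong (_xor f (false ∷ σ)) (xor-same a) ⟩
  f (false ∷ σ) ∎
  where a = ∂ (f ∘ (true ∷_)) σ

hasSize : ∀ {n} → ℕ → Subset n → Bool
hasSize k σ = ∣ σ ∣ ≡ᵇ k

∂-hasSize0 : ∀ {n} (ε : Subset n) → ∂ (hasSize 0) ε ≡ hasSize 1 ε
∂-hasSize0 [] = refl
∂-hasSize0 (true ∷ σ) = trans (cong (hasSize 0 σ xor_) (∂-false σ)) (xor-identityʳ _)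
∂-hasSize0 (false ∷ σ) = ∂-hasSize0 σ

∂-hasSize1 : ∀ {n} (ε : Subset n) → ∂ (hasSize 1) ε ≡ false
∂-hasSize1 [] = refl
∂-hasSize1 (true ∷ σ) = trans (cong (hasSize 1 σ xor_) (∂-hasSize0 σ)) (xor-same (hasSize 1 σ))
∂-hasSize1 (false ∷ σ) = ∂-hasSize1 σ

-- Chains concentrated on the diagonal S = ε

Diagonal : ∀ {m} → Chain m → Set
Diagonal c = ∀ ε S → c ε S ≡ true → S ≡ ε

diag : ∀ {m} → Chain m → Subset m → Bool
diag c σ = c σ σ

onDiagonal : ∀ {m} → (Subset m → Bool) → Chain m
onDiagonal f ε S = ⌊ S ≟ˢ ε ⌋ ∧ f ε

onDiagonal-Diagonal : ∀ {m} (f : Subset m → Bool) → Diagonal (onDiagonal f)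
onDiagonal-Diagonal f ε S e = ⌊⌋≡true⇒ (S ≟ˢ ε) (∧-conicalˡ _ _ e)

diag-onDiagonal : ∀ {m} {f : Subset m → Bool} σ → diag (onDiagonal f) σ ≡ f σ
diag-onDiagonal {f = f} σ = cong (_∧ f σ) (⌊⌋-true (σ ≟ˢ σ) refl)

-- Only the face ε ∖ i ⊆ ε of each colouring contributes to d on diagonal chains.
d-Diagonal : ∀ {m} (G : SimpleGraph m) {c : Chain m} → Diagonal c →
  ∀ ε → d G c ε ε ≡ ∂ (diag c) ε
d-Diagonal {m} G {c} diagonal ε =
  trans (cong ⊕ (List.map-tabulate id summand))
        (cong ⊕ (List.tabulate-cong λ i → cong (if lookup ε i then_else false) (face i)))
  where
  summand : Fin m → Bool
  summand i = if lookup ε i then ⊕ (map (λ S → c (ε [ i ]≔ false) S ∧ (S ⊆ᵇ ε)) (allSubsets m)) else false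
  face : ∀ i → ⊕ (map (λ S → c (ε [ i ]≔ false) S ∧ (S ⊆ᵇ ε)) (allSubsets m))
               ≡ c (ε [ i ]≔ false) (ε [ i ]≔ false)
  face i = begin
    ⊕ (map (λ S → c (ε [ i ]≔ false) S ∧ (S ⊆ᵇ ε)) (allSubsets m))
      ≡⟨ ⊕-allSubsets-SupportedAt _ _ (λ S e → diagonal _ S (∧-conicalˡ _ _ e)) ⟩
    c (ε [ i ]≔ false) (ε [ i ]≔ false) ∧ ((ε [ i ]≔ false) ⊆ᵇ ε)
      ≡⟨ cong (c (ε [ i ]≔ false) (ε [ i ]≔ false) ∧_) ([]≔false-⊆ᵇ ε i) ⟩
    c (ε [ i ]≔ false) (ε [ i ]≔ false) ∧ true
      ≡⟨ ∧-identityʳ _ ⟩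
    c (ε [ i ]≔ false) (ε [ i ]≔ false) ∎

d-vanishing : ∀ {m} (G : SimpleGraph m) {c : Chain m} → (∀ ε S → c ε S ≡ false) →
  ∀ ε → d G c ε ε ≡ false
d-vanishing G {c} c≡false ε = begin
  d G c ε ε               ≡⟨ d-Diagonal G (λ ε S e → contradiction (trans (sym e) (c≡false ε S)) λ ()) ε ⟩
  ∂ (diag c) ε            ≡⟨ ∂-cong (λ σ → c≡false σ σ) ε ⟩
  ∂ (λ _ → false) ε       ≡⟨ ∂-false ε ⟩
  false ∎

InC-K⇒Diagonal : ∀ {m j} {c : Chain m} → InC (K m) j c → Diagonal c
InC-K⇒Diagonal inC ε S e = isComponent-K⇒≡ (proj₂ (inC ε S e))

InC-0⇒≡false : ∀ {m} {G : SimpleGraph m} {c : Chain m} → InC G 0 c → ∀ ε S → c ε S ≡ false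
InC-0⇒≡false {c = c} inC ε S with c ε S in e
... | false = refl
... | true with inC ε S e
... | ∣ε∣≡0 , (v , v∈ε , _) = contradiction ∣ε∣≡0 (∈⇒∣p∣≢0 v∈ε)

InC-onDiagonal : ∀ {m k} {f : Subset m → Bool} → (∀ σ → f σ ≡ true → ∣ σ ∣ ≡ suc k) →
  InC (K m) (suc k) (onDiagonal f)
InC-onDiagonal {f = f} supp ε S e with onDiagonal-Diagonal f ε S e
... | refl with ∣p∣≡suc⇒Nonempty ε (supp ε (∧-conicalʳ _ _ e))
... | v , v∈ε = supp ε (∧-conicalʳ _ _ e) , isComponent-K v∈ε

diag≗⇒≈-K : ∀ {m j} {c c' : Chain m} → (∀ ε → ∣ ε ∣ ≡ j → c ε ε ≡ c' ε ε) → c ≈[ K m , j ] c'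
diag≗⇒≈-K c≗c' ε S ∣ε∣≡j S∈π₀ with isComponent-K⇒≡ S∈π₀
... | refl = c≗c' ε ∣ε∣≡j

isCycle⇒∂≡false : ∀ {m j} {c : Chain m} → IsCycle (K m) j c →
  ∀ ε → ∣ ε ∣ ≡ suc j → ∂ (diag c) ε ≡ false
isCycle⇒∂≡false (inC , dc≈0) ε ∣ε∣≡1+j with ∣p∣≡suc⇒Nonempty ε ∣ε∣≡1+j
... | v , v∈ε = trans (sym (d-Diagonal (K _) (InC-K⇒Diagonal inC) ε))
                      (dc≈0 ε ε ∣ε∣≡1+j (isComponent-K v∈ε))

isCycle⇒≡∂cone : ∀ {n k} {c : Chain (suc n)} → IsCycle (K (suc n)) (suc k) c →
  ∀ ε → ∣ ε ∣ ≡ suc k → diag c ε ≡ ∂ (cone (diag c)) ε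
isCycle⇒≡∂cone {k = k} {c} cyc ε ∣ε∣≡1+k = begin
  diag c ε                               ≡⟨ sym (∂-cone (diag c) ε) ⟩
  ∂ (cone (diag c)) ε xor cone (∂ (diag c)) ε
                                         ≡⟨ cong (∂ (cone (diag c)) ε xor_) (cone-∂≡false ε ∣ε∣≡1+k) ⟩
  ∂ (cone (diag c)) ε xor false          ≡⟨ xor-identityʳ _ ⟩
  ∂ (cone (diag c)) ε ∎
  where
  cone-∂≡false : ∀ ε → ∣ ε ∣ ≡ suc k → cone (∂ (diag c)) ε ≡ false
  cone-∂≡false (true ∷ σ) _ = refl
  cone-∂≡false (false ∷ σ) ∣σ∣≡1+k = isCycle⇒∂≡false cyc (true ∷ σ) (cong suc ∣σ∣≡1+k)

isBoundary-0 : ∀ {m} (G : SimpleGraph m) c → IsBoundary G 0 c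
isBoundary-0 G c ε S ∣ε∣≡0 (v , v∈ε , _) = contradiction ∣ε∣≡0 (∈⇒∣p∣≢0 v∈ε)

isCycle⇒isBoundary-≥2 : ∀ {n k} (c : Chain (suc n)) → IsCycle (K (suc n)) (suc (suc k)) c →
  IsBoundary (K (suc n)) (suc (suc k)) c
isCycle⇒isBoundary-≥2 {k = k} c cyc@(inC , _) =
  onDiagonal (cone (diag c)) , InC-onDiagonal cone-support , diag≗⇒≈-K λ ε ∣ε∣ → begin
    d (K _) (onDiagonal (cone (diag c))) ε ε  ≡⟨ d-Diagonal (K _) (onDiagonal-Diagonal (cone (diag c))) ε ⟩
    ∂ (diag (onDiagonal (cone (diag c)))) ε   ≡⟨ ∂-cong (diag-onDiagonal {f = cone (diag c)}) ε ⟩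
    ∂ (cone (diag c)) ε                       ≡⟨ sym (isCycle⇒≡∂cone cyc ε ∣ε∣) ⟩
    c ε ε ∎
  where
  cone-support : ∀ σ → cone (diag c) σ ≡ true → ∣ σ ∣ ≡ suc k
  cone-support (true ∷ σ) ()
  cone-support (false ∷ σ) e = suc-injective (proj₁ (inC _ _ e))

isSingletonPair : ∀ {m} → Subset m → Subset m → Fin m → Bool
isSingletonPair ε S i = ⌊ ε ≟ˢ ⁅ i ⁆ ⌋ ∧ ⌊ S ≟ˢ ⁅ i ⁆ ⌋

singletonSum⇒⁅⁆ : ∀ {m} ε S → singletonSum m ε S ≡ true → Σ (Fin m) λ i → ε ≡ ⁅ i ⁆ × S ≡ ⁅ i ⁆
singletonSum⇒⁅⁆ {m} ε S e =
  let i , both = satisfied (any⁻ (isSingletonPair ε S) (allFin m) (Equivalence.from T-≡ e))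
      ε≡⁅i⁆ , S≡⁅i⁆ = Equivalence.to (T-∧ {⌊ ε ≟ˢ ⁅ i ⁆ ⌋}) both
  in i , toWitness {a? = ε ≟ˢ ⁅ i ⁆} ε≡⁅i⁆ , toWitness {a? = S ≟ˢ ⁅ i ⁆} S≡⁅i⁆

singletonSum-⁅⁆ : ∀ {m} (i : Fin m) → singletonSum m ⁅ i ⁆ ⁅ i ⁆ ≡ true
singletonSum-⁅⁆ i = Equivalence.to T-≡
  (any⁺ (isSingletonPair ⁅ i ⁆ ⁅ i ⁆) (lose (∈-allFin i) (Equivalence.from (T-∧ {⌊ ⁅ i ⁆ ≟ˢ ⁅ i ⁆ ⌋}) (fromWitness refl , fromWitness refl))))

diag-singletonSum : ∀ {m} (σ : Subset m) → diag (singletonSum m) σ ≡ hasSize 1 σ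
diag-singletonSum {m} σ = ⇔→≡ (mk⇔ to from)
  where
  to : singletonSum m σ σ ≡ true → hasSize 1 σ ≡ true
  to e with singletonSum⇒⁅⁆ σ σ e
  ... | i , σ≡⁅i⁆ , _ =
    Equivalence.to T-≡ (≡⇒≡ᵇ ∣ σ ∣ 1 (trans (cong ∣_∣ σ≡⁅i⁆) (∣⁅x⁆∣≡1 i)))
  from : hasSize 1 σ ≡ true → singletonSum m σ σ ≡ true
  from e with ∣p∣≡1⇒p≡⁅x⁆ σ (≡ᵇ⇒≡ ∣ σ ∣ 1 (Equivalence.from T-≡ e))
  ... | i , σ≡⁅i⁆ = trans (cong (λ τ → singletonSum m τ τ) σ≡⁅i⁆) (singletonSum-⁅⁆ i)

singletonSum-isCycle : ∀ m → IsCycle (K m) 1 (singletonSum m)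
singletonSum-isCycle m = inC , diag≗⇒≈-K λ ε _ → begin
  d (K m) (singletonSum m) ε ε   ≡⟨ d-Diagonal (K m) (InC-K⇒Diagonal inC) ε ⟩
  ∂ (diag (singletonSum m)) ε    ≡⟨ ∂-cong diag-singletonSum ε ⟩
  ∂ (hasSize 1) ε                ≡⟨ ∂-hasSize1 ε ⟩
  false ∎
  where
  inC : InC (K m) 1 (singletonSum m)
  inC ε S e with singletonSum⇒⁅⁆ ε S e
  ... | i , refl , refl = ∣⁅x⁆∣≡1 i , isComponent-K (x∈⁅x⁆ i)

singletonSum-¬isBoundary : ∀ {m} → Fin m → ¬ IsBoundary (K m) 1 (singletonSum m)
singletonSum-¬isBoundary i (b , inC , db≈s) = contradiction
  (trans (sym (db≈s ⁅ i ⁆ ⁅ i ⁆ (∣⁅x⁆∣≡1 i) (isComponent-K (x∈⁅x⁆ i))))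
         (d-vanishing (K _) (InC-0⇒≡false inC) ⁅ i ⁆))
  (λ s≡false → contradiction (trans (sym s≡false) (singletonSum-⁅⁆ i)) λ ())

isCycle-1⇒constant : ∀ {n} {c : Chain (suc n)} → IsCycle (K (suc n)) 1 c →
  ∀ i → c ⁅ i ⁆ ⁅ i ⁆ ≡ c ⁅ zero ⁆ ⁅ zero ⁆
isCycle-1⇒constant {c = c} cyc i =
  trans (isCycle⇒≡∂cone cyc ⁅ i ⁆ (∣⁅x⁆∣≡1 i)) (∂-⁅⁆ (cone (diag c)) i)

vanishing-on-⁅⁆⇒isBoundary-1 : ∀ {m} {c : Chain m} → (∀ i → c ⁅ i ⁆ ⁅ i ⁆ ≡ false) →
  IsBoundary (K m) 1 c
vanishing-on-⁅⁆⇒isBoundary-1 {c = c} c≡false = zeroC , (λ _ _ ()) , diag≗⇒≈-K d0≡c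
  where
  d0≡c : ∀ ε → ∣ ε ∣ ≡ 1 → d (K _) zeroC ε ε ≡ c ε ε
  d0≡c ε ∣ε∣≡1 with ∣p∣≡1⇒p≡⁅x⁆ ε ∣ε∣≡1
  ... | i , refl = trans (d-vanishing (K _) (λ _ _ → refl) ⁅ i ⁆) (sym (c≡false i))

isCycle-1⇒isBoundary⊎isBoundary+singletonSum : ∀ {n} c → IsCycle (K (suc n)) 1 c →
  IsBoundary (K (suc n)) 1 c ⊎ IsBoundary (K (suc n)) 1 (c +C singletonSum (suc n))
isCycle-1⇒isBoundary⊎isBoundary+singletonSum c cyc with c ⁅ zero ⁆ ⁅ zero ⁆ in c₀
... | false = inj₁ (vanishing-on-⁅⁆⇒isBoundary-1 λ i → trans (isCycle-1⇒constant cyc i) c₀)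
... | true = inj₂ (vanishing-on-⁅⁆⇒isBoundary-1 λ i →
  cong₂ _xor_ (trans (isCycle-1⇒constant cyc i) c₀) (singletonSum-⁅⁆ i))

proposition8p1 : ∀ (m : ℕ) → 1 ≤ m →
    (∀ (j : ℕ) → j ≢ 1 → ∀ c → IsCycle (K m) j c → IsBoundary (K m) j c)
    × IsCycle (K m) 1 (singletonSum m)
    × ¬ IsBoundary (K m) 1 (singletonSum m)
    × (∀ c → IsCycle (K m) 1 c →
         IsBoundary (K m) 1 c ⊎ IsBoundary (K m) 1 (c +C singletonSum m))
proposition8p1 (suc n) _ =
  acyclic-off-1 , singletonSum-isCycle (suc n) , singletonSum-¬isBoundary zero ,
  isCycle-1⇒isBoundary⊎isBoundary+singletonSum
  where
  acyclic-off-1 : ∀ j → j ≢ 1 → ∀ c → IsCycle (K (suc n)) j c → IsBoundary (K (suc n)) j c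
  acyclic-off-1 zero _ c _ = isBoundary-0 (K _) c
  acyclic-off-1 (suc zero) j≢1 _ _ = contradiction refl j≢1
  acyclic-off-1 (suc (suc k)) _ = isCycle⇒isBoundary-≥2
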